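{- For every $n\ge 1$, every edge 2-coloring of the complete graph $K_n$ has a color group of size at least $\left\lceil \frac{n(n-1)}{6}\right\rceil$; that is, $\mathrm{OPT}(K_n)\ge \left\lceil \frac{1}{3}|E(K_n)|\right\rceil=\left\lceil \frac{n(n-1)}{6}\right\rceil$.
   Context: An edge 2-coloring of a graph is an assignment of colors to its edges such that each vertex is incident to edges of at most 2 distinct colors. A color group is the set of all edges receiving a given color. $\mathrm{OPT}(G)$ denotes the minimum, over all edge 2-colorings of $G$, of the size of the largest color group. -}

module Defs where

open import Data.Nat using (ℕ; _*_; _+_; _∸_; _/_)
open import Data.Fin using (Fin; _<_)
open import Data.Fin.Properties using (_<?_)
open import Data.List using (List; allFin; concatMap; filter; length; map)
open import Data.Product using (Σ; _×_; _,_; proj₁; proj₂; ∃)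
open import Data.Sum using (_⊎_)
open import Relation.Binary.PropositionalEquality using (_≡_)
open import Relation.Binary.Definitions using (DecidableEquality)

-- An edge of K_n on vertex set Fin n: an unordered pair {i , j}, represented
-- canonically as (i , j) with i < j.
Edge : ℕ → Set
Edge n = Σ (Fin n × Fin n) λ p → proj₁ p < proj₂ p

edges : (n : ℕ) → List (Edge n)
edges n = concatMap (λ i → concatMap (λ j → pairs i j (i <? j)) (allFin n)) (allFin n)
  where
  open import Relation.Nullary using (Dec; yes; no)
  open import Data.List using ([]; [_])
  pairs : (i j : Fin n) → Dec (i < j) → List (Edge n)
  pairs i j (yes p) = [ ((i , j) , p) ]
  pairs i j (no _)  = []

Incident : {n : ℕ} → Fin n → Edge n → Set
Incident v ((i , j) , _) = (v ≡ i) ⊎ (v ≡ j)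

-- An edge 2-coloring with colors in C: every vertex sees at most 2 distinct colors,
-- i.e. there are colors a, b such that each incident edge has color a or b.
IsEdge2Coloring : {n : ℕ} {C : Set} → (Edge n → C) → Set
IsEdge2Coloring {n} {C} c =
  (v : Fin n) → Σ C λ a → Σ C λ b →
    (e : Edge n) → Incident v e → (c e ≡ a) ⊎ (c e ≡ b)

colorGroupSize : {n : ℕ} {C : Set} → DecidableEquality C → (Edge n → C) → C → ℕ
colorGroupSize {n} _≟_ c k = length (filter (λ e → c e ≟ k) (edges n))

numEdgesK : ℕ → ℕ
numEdgesK n = (n * (n ∸ 1)) / 2

ceilDiv6 : ℕ → ℕ
ceilDiv6 m = (m + 5) / 6

module Submission where

-- It suffices to find a colour whose degree sum, twice the size of its colour group, is at
-- least n(n-1)/3. Let {a, b} be the palette of some vertex v.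
-- If a colour a lies in every palette, every edge at u has colour a or the second colour
-- z(u) of u, and a non-a edge joins two vertices with the same second colour. Either a is
-- heavy, or some vertex u₀ has at least 2(n-1)/3 non-a edges. In the latter case let
-- x = z(u₀): the r vertices whose second colour is not x are joined to u₀ by a-edges, so
-- 3r ≤ n-1, and since their non-a edges stay among themselves, all non-a edges but at most
-- r² have colour x; hence x or a is heavy.
-- Otherwise some u₁ misses a and some u₂ misses b; the edges v u₁, v u₂, u₁ u₂ then force
-- every edge to use one of three colours, and one of these is heavy.

open import Defs
open import Data.Nat using (ℕ; _≤_; _*_; _∸_)
open import Data.Fin using (Fin)
open import Data.Product using (Σ)
open import Relation.Binary.Definitions using (DecidableEquality)

open import Level using (Level)
open import Data.Bool.Base using (true; false; if_then_else_)
open import Data.Nat using (zero; suc; _+_; z≤n; s≤s; _≤?_)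
open import Data.Nat.Properties
open import Data.Nat.DivMod using (m<n*o⇒m/o<n)
open import Data.Nat.Tactic.RingSolver using (solve-∀)
open import Data.Fin using (zero; suc; fromℕ<) renaming (_<_ to _<ᶠ_)
open import Data.Fin.Properties using (all?; any?; ¬∀⟶∃¬)
  renaming (_≟_ to _≟ᶠ_; _<?_ to _<ᶠ?_; <-asym to <ᶠ-asym; <⇒≢ to <ᶠ⇒≢; ≤-antisym to ≤ᶠ-antisym)
open import Data.List using (List; []; [_]; _++_; length; filter; concatMap; allFin; tabulate)
open import Data.List.Properties using (filter-++; length-++)
open import Data.Product using (_×_; _,_; proj₁; proj₂; ∃)
open import Data.Sum using (_⊎_; inj₁; inj₂; [_,_]′) renaming (map to ⊎-map)
open import Data.Empty using (⊥; ⊥-elim)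
open import Function using (_∘_; id)
open import Relation.Nullary using (Dec; yes; no; does; _because_; ¬_; ¬?; contradiction)
open import Relation.Nullary.Decidable using (_×-dec_; _⊎-dec_; decidable-stable)
open import Relation.Unary using (Pred; Decidable; _⊆_)
open import Relation.Unary.Properties using (_∪?_; _∩?_; ∁?)
open import Relation.Binary.PropositionalEquality
  using (_≡_; _≢_; refl; sym; trans; cong; subst; module ≡-Reasoning)
open import Algebra.Properties.Semiring.Sum +-*-semiring
  using (sum-syntax; ∑-distrib-+; ∑-comm; sum-cong-≗; *-distribʳ-sum)

private
  variable
    ℓ ℓ′ : Level
    A B : Set ℓ
    P : Set ℓ
    Q : Set ℓ′

-- Only `does` is inspected, so 𝟙 (map′ f g P?) reduces to 𝟙 P?.
𝟙 : Dec P → ℕ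
𝟙 P? = if does P? then 1 else 0

𝟙-no : ¬ P → (P? : Dec P) → 𝟙 P? ≡ 0
𝟙-no ¬p (yes p)            = contradiction p ¬p
𝟙-no ¬p (false because _)  = refl

𝟙-mono : (P → Q) → (P? : Dec P) (Q? : Dec Q) → 𝟙 P? ≤ 𝟙 Q?
𝟙-mono f (false because _) _                  = z≤n
𝟙-mono f (true because _)  (true because _)   = ≤-refl
𝟙-mono f (yes p)           (no ¬q)            = contradiction (f p) ¬q

𝟙-⊎ : (P? : Dec P) (Q? : Dec Q) → 𝟙 (P? ⊎-dec Q?) ≤ 𝟙 P? + 𝟙 Q?
𝟙-⊎ (true because _)  _                 = s≤s z≤n
𝟙-⊎ (false because _) (true because _)  = ≤-refl
𝟙-⊎ (false because _) (false because _) = z≤n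

𝟙-×-∁ : (P? : Dec P) (Q? : Dec Q) → 𝟙 (P? ×-dec Q?) + 𝟙 (P? ×-dec ¬? Q?) ≡ 𝟙 P?
𝟙-×-∁ (true because _)  (true because _)  = refl
𝟙-×-∁ (true because _)  (false because _) = refl
𝟙-×-∁ (false because _) _                 = refl

𝟙-∁ : (P? : Dec P) → 𝟙 (¬? P?) + 𝟙 P? ≡ 1
𝟙-∁ (true because _)  = refl
𝟙-∁ (false because _) = refl

𝟙-×-true : P → (P? : Dec P) (Q? : Dec Q) → 𝟙 (P? ×-dec Q?) ≡ 𝟙 Q?
𝟙-×-true p (yes _)  (true because _)  = refl
𝟙-×-true p (yes _)  (false because _) = refl
𝟙-×-true p (no ¬p)  _                 = contradiction p ¬p

length-filter-[_] : {P : Pred A ℓ′} (P? : Decidable P) (x : A) → length (filter P? [ x ]) ≡ 𝟙 (P? x)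
length-filter-[ P? ] x with P? x
... | yes _ = refl
... | no _  = refl

length-filter-concatMap-tabulate : {P : Pred A ℓ′} (P? : Decidable P) {n : ℕ} (g : Fin n → B) (f : B → List A) →
  length (filter P? (concatMap f (tabulate g))) ≡ ∑[ i < n ] length (filter P? (f (g i)))
length-filter-concatMap-tabulate P? {zero}  g f = refl
length-filter-concatMap-tabulate P? {suc n} g f = begin
  length (filter P? (f (g zero) ++ concatMap f (tabulate (g ∘ suc))))
    ≡⟨ cong length (filter-++ P? (f (g zero)) _) ⟩
  length (filter P? (f (g zero)) ++ filter P? (concatMap f (tabulate (g ∘ suc))))
    ≡⟨ length-++ (filter P? (f (g zero))) ⟩
  length (filter P? (f (g zero))) + length (filter P? (concatMap f (tabulate (g ∘ suc))))
    ≡⟨ cong (length (filter P? (f (g zero))) +_) (length-filter-concatMap-tabulate P? (g ∘ suc) f) ⟩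
  length (filter P? (f (g zero))) + ∑[ i < n ] length (filter P? (f (g (suc i)))) ∎
  where open ≡-Reasoning

∑-mono-≤ : ∀ {n} {f g : Fin n → ℕ} → (∀ i → f i ≤ g i) → ∑[ i < n ] f i ≤ ∑[ i < n ] g i
∑-mono-≤ {zero}  f≤g = z≤n
∑-mono-≤ {suc n} f≤g = +-mono-≤ (f≤g zero) (∑-mono-≤ (f≤g ∘ suc))

∑-const : ∀ n k → ∑[ i < n ] k ≡ n * k
∑-const zero    k = refl
∑-const (suc n) k = cong (k +_) (∑-const n k)

count : ∀ {n} {P : Pred (Fin n) ℓ} → Decidable P → ℕ
count {n = n} P? = ∑[ i < n ] 𝟙 (P? i)

module _ {n : ℕ} {P : Pred (Fin n) ℓ} {Q : Pred (Fin n) ℓ′} where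

  count-mono : P ⊆ Q → (P? : Decidable P) (Q? : Decidable Q) → count P? ≤ count Q?
  count-mono P⊆Q P? Q? = ∑-mono-≤ λ i → 𝟙-mono P⊆Q (P? i) (Q? i)

  count-∪ : (P? : Decidable P) (Q? : Decidable Q) → count (P? ∪? Q?) ≤ count P? + count Q?
  count-∪ P? Q? = ≤-trans (∑-mono-≤ λ i → 𝟙-⊎ (P? i) (Q? i))
    (≤-reflexive (∑-distrib-+ (λ i → 𝟙 (P? i)) (λ i → 𝟙 (Q? i))))

  count-∩-∁ : (P? : Decidable P) (Q? : Decidable Q) → count (P? ∩? Q?) + count (P? ∩? ∁? Q?) ≡ count P?
  count-∩-∁ P? Q? = trans (sym (∑-distrib-+ (λ i → 𝟙 ((P? ∩? Q?) i)) (λ i → 𝟙 ((P? ∩? ∁? Q?) i))))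
    (sum-cong-≗ λ i → 𝟙-×-∁ (P? i) (Q? i))

count-∁ : ∀ {n} {P : Pred (Fin n) ℓ} (P? : Decidable P) → count (∁? P?) + count P? ≡ n
count-∁ {n = n} P? = begin
  count (∁? P?) + count P?       ≡⟨ ∑-distrib-+ (λ i → 𝟙 (¬? (P? i))) (λ i → 𝟙 (P? i)) ⟨
  ∑[ i < n ] (𝟙 (¬? (P? i)) + 𝟙 (P? i)) ≡⟨ sum-cong-≗ (𝟙-∁ ∘ P?) ⟩
  ∑[ i < n ] 1                   ≡⟨ ∑-const n 1 ⟩
  n * 1                          ≡⟨ *-identityʳ n ⟩
  n                              ∎
  where open ≡-Reasoning

count-≡ : ∀ {n} (u : Fin n) → count (u ≟ᶠ_) ≡ 1
count-≡ {suc n} zero    = cong suc (trans (∑-const n 0) (*-zeroʳ n))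
count-≡ {suc n} (suc u) = count-≡ u

count-≢ : ∀ {n} (u : Fin n) → count (∁? (u ≟ᶠ_)) ≡ n ∸ 1
count-≢ {n} u = begin
  count (∁? (u ≟ᶠ_))             ≡⟨ m+n∸n≡m _ 1 ⟨
  count (∁? (u ≟ᶠ_)) + 1 ∸ 1     ≡⟨ cong (λ k → count (∁? (u ≟ᶠ_)) + k ∸ 1) (count-≡ u) ⟨
  count (∁? (u ≟ᶠ_)) + count (u ≟ᶠ_) ∸ 1 ≡⟨ cong (_∸ 1) (count-∁ (u ≟ᶠ_)) ⟩
  n ∸ 1                          ∎
  where open ≡-Reasoning

third-of-split : ∀ {d s t} → d + s ≡ t → s * 3 ≤ t * 2 → t ≤ 3 * d
third-of-split {d} {s} refl s*3≤ = +-cancelʳ-≤ ((d + s) * 2) (d + s) (3 * d) (begin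
  d + s + (d + s) * 2 ≡⟨ regroup d s ⟩
  3 * d + s * 3       ≤⟨ +-monoʳ-≤ (3 * d) s*3≤ ⟩
  3 * d + (d + s) * 2 ∎)
  where
  open ≤-Reasoning
  regroup : ∀ d s → d + s + (d + s) * 2 ≡ 3 * d + s * 3
  regroup = solve-∀

pigeonhole₃ : ∀ {t x y z} → t ≤ x + (y + z) → t ≤ 3 * x ⊎ t ≤ 3 * y ⊎ t ≤ 3 * z
pigeonhole₃ {t} {x} {y} {z} t≤ with t ≤? 3 * x | t ≤? 3 * y | t ≤? 3 * z
... | yes t≤3x | _        | _        = inj₁ t≤3x
... | no _     | yes t≤3y | _        = inj₂ (inj₁ t≤3y)
... | no _     | no _     | yes t≤3z = inj₂ (inj₂ t≤3z)
... | no t≰3x  | no t≰3y  | no t≰3z  = contradiction (begin-strict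
  3 * t                       ≤⟨ *-monoʳ-≤ 3 t≤ ⟩
  3 * (x + (y + z))           ≡⟨ spread x y z ⟩
  3 * x + (3 * y + 3 * z)     <⟨ +-mono-< (≰⇒> t≰3x) (+-mono-< (≰⇒> t≰3y) (≰⇒> t≰3z)) ⟩
  t + (t + t)                 ≡⟨ triple t ⟩
  3 * t                       ∎) (<-irrefl refl)
  where
  open ≤-Reasoning
  spread : ∀ x y z → 3 * (x + (y + z)) ≡ 3 * x + (3 * y + 3 * z)
  spread = solve-∀
  triple : ∀ t → t + (t + t) ≡ 3 * t
  triple = solve-∀

star-arith : ∀ n {r c s d} → (n ∸ 1) * 2 ≤ c * 3 → r + c ≤ n ∸ 1 → s ≤ d + r * r →
             3 * d ≤ n * (n ∸ 1) → s * 3 ≤ n * (n ∸ 1) * 2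
star-arith n {r} {c} {s} {d} 2N≤3c r+c≤N s≤ 3d≤T = *-cancelˡ-≤ 3 (begin
  3 * (s * 3)                     ≡⟨ nine s ⟩
  9 * s                           ≤⟨ *-monoʳ-≤ 9 s≤ ⟩
  9 * (d + r * r)                 ≡⟨ expand d r ⟩
  3 * (3 * d) + (3 * r) * (3 * r) ≤⟨ +-mono-≤ (*-monoʳ-≤ 3 3d≤T) (*-mono-≤ 3r≤N 3r≤N) ⟩
  3 * T + N * N                   ≤⟨ +-monoʳ-≤ (3 * T) N*N≤3T ⟩
  3 * T + 3 * T                   ≡⟨ double T ⟩
  3 * (T * 2)                     ∎)
  where
  open ≤-Reasoning
  N T : ℕ
  N = n ∸ 1
  T = n * N
  3r≤N : 3 * r ≤ N
  3r≤N = +-cancelʳ-≤ (N * 2) (3 * r) N (begin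
    3 * r + N * 2  ≤⟨ +-monoʳ-≤ (3 * r) 2N≤3c ⟩
    3 * r + c * 3  ≡⟨ factor r c ⟩
    3 * (r + c)    ≤⟨ *-monoʳ-≤ 3 r+c≤N ⟩
    3 * N          ≡⟨ split N ⟩
    N + N * 2      ∎)
    where
    factor : ∀ r c → 3 * r + c * 3 ≡ 3 * (r + c)
    factor = solve-∀
    split : ∀ N → 3 * N ≡ N + N * 2
    split = solve-∀
  N*N≤3T : N * N ≤ 3 * T
  N*N≤3T = ≤-trans (*-monoˡ-≤ N (m∸n≤m n 1)) (m≤n*m T 3)
  nine : ∀ s → 3 * (s * 3) ≡ 9 * s
  nine = solve-∀
  expand : ∀ d r → 9 * (d + r * r) ≡ 3 * (3 * d) + (3 * r) * (3 * r)
  expand = solve-∀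
  double : ∀ T → 3 * T + 3 * T ≡ 3 * (T * 2)
  double = solve-∀

ceilDiv6-≤ : ∀ {m s} → m ≤ 3 * (2 * s) → ceilDiv6 m ≤ s
ceilDiv6-≤ {m} {s} m≤ = ≤-pred (m<n*o⇒m/o<n (begin-strict
  m + 5                 <⟨ +-monoˡ-< 5 (s≤s m≤) ⟩
  suc (3 * (2 * s)) + 5 ≡⟨ six s ⟩
  suc s * 6             ∎))
  where
  open ≤-Reasoning
  six : ∀ s → suc (3 * (2 * s)) + 5 ≡ suc s * 6
  six = solve-∀

_∈₂_ : A → A × A → Set _
x ∈₂ p = x ≡ proj₁ p ⊎ x ≡ proj₂ p

module _ {x y z : A} where

  ∈₂-≢ˡ : x ∈₂ (y , z) → x ≢ y → x ≡ z
  ∈₂-≢ˡ (inj₁ x≡y) x≢y = contradiction x≡y x≢y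
  ∈₂-≢ˡ (inj₂ x≡z) _   = x≡z

  ∈₂-≢ʳ : x ∈₂ (y , z) → x ≢ z → x ≡ y
  ∈₂-≢ʳ (inj₁ x≡y) _   = x≡y
  ∈₂-≢ʳ (inj₂ x≡z) x≢z = contradiction x≡z x≢z

∈₂-∉ : ∀ {x y : A} {p} → x ∈₂ p → ¬ y ∈₂ p → x ≢ y
∈₂-∉ {p = p} x∈p y∉p x≡y = y∉p (subst (_∈₂ p) x≡y x∈p)

∈₂-triangle : ∀ {x y z o : A} → y ≢ x → z ≢ x → z ≢ y →
              o ∈₂ (x , y) → o ∈₂ (y , z) → o ∈₂ (x , z) → ⊥
∈₂-triangle y≢x z≢x z≢y (inj₁ refl) (inj₁ refl) _           = y≢x refl
∈₂-triangle y≢x z≢x z≢y (inj₁ refl) (inj₂ refl) _           = z≢x refl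
∈₂-triangle y≢x z≢x z≢y (inj₂ refl) _           (inj₁ refl) = y≢x refl
∈₂-triangle y≢x z≢x z≢y (inj₂ refl) _           (inj₂ refl) = z≢y refl

module _ (_≟_ : DecidableEquality A) where

  _∈₂?_ : (x : A) (p : A × A) → Dec (x ∈₂ p)
  x ∈₂? p = (x ≟ proj₁ p) ⊎-dec (x ≟ proj₂ p)

  other : A → A × A → A
  other x (y , z) with y ≟ x
  ... | yes _ = z
  ... | no _  = y

  ∈₂-other : ∀ {x y} p → x ∈₂ p → y ∈₂ p → y ∈₂ (x , other x p)
  ∈₂-other {x} (u , v) x∈p y∈p with u ≟ x
  ∈₂-other (u , v) _          (inj₁ y≡u) | yes u≡x = inj₁ (trans y≡u u≡x)
  ∈₂-other (u , v) _          (inj₂ y≡v) | yes _   = inj₂ y≡v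
  ∈₂-other (u , v) _          (inj₁ y≡u) | no _    = inj₂ y≡u
  ∈₂-other (u , v) (inj₁ x≡u) (inj₂ _)   | no u≢x  = contradiction (sym x≡u) u≢x
  ∈₂-other (u , v) (inj₂ x≡v) (inj₂ y≡v) | no _    = inj₁ (trans y≡v (sym x≡v))

  other-∈₂ : ∀ x p → other x p ∈₂ p
  other-∈₂ x (u , v) with u ≟ x
  ... | yes _ = inj₂ refl
  ... | no _  = inj₁ refl

module PairColouring {n : ℕ} {C : Set} (_≟_ : DecidableEquality C)
  (col : Fin n → Fin n → C) (col-sym : ∀ u w → col u w ≡ col w u)
  (palette : Fin n → C × C) (col-∈ : ∀ u w → col u w ∈₂ palette u) where

  -- The values col u u play no role beyond col-∈: degrees only count pairs u ≢ w.

  col-∈ʳ : ∀ u w → col u w ∈₂ palette w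
  col-∈ʳ u w = subst (_∈₂ palette w) (col-sym w u) (col-∈ w u)

  col≡⇒∈ʳ : ∀ {x} u w → col u w ≡ x → x ∈₂ palette w
  col≡⇒∈ʳ u w col≡x = subst (_∈₂ palette w) col≡x (col-∈ʳ u w)

  col-≢-∉ʳ : ∀ {x} u w → ¬ x ∈₂ palette w → col u w ≢ x
  col-≢-∉ʳ u w = ∈₂-∉ (col-∈ʳ u w)

  neighbour? : (u : Fin n) → Decidable (u ≢_)
  neighbour? u = ∁? (u ≟ᶠ_)

  neighbour-via? : (k : C) (u : Fin n) → Decidable (λ w → u ≢ w × col u w ≡ k)
  neighbour-via? k u = neighbour? u ∩? λ w → col u w ≟ k

  neighbour-not-via? : (k : C) (u : Fin n) → Decidable (λ w → u ≢ w × col u w ≢ k)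
  neighbour-not-via? k u = neighbour? u ∩? ∁? λ w → col u w ≟ k

  degree : C → Fin n → ℕ
  degree k u = count (neighbour-via? k u)

  codegree : C → Fin n → ℕ
  codegree k u = count (neighbour-not-via? k u)

  degreeSum : C → ℕ
  degreeSum k = ∑[ u < n ] degree k u

  Heavy : C → Set
  Heavy k = n * (n ∸ 1) ≤ 3 * degreeSum k

  degree+codegree : ∀ k u → degree k u + codegree k u ≡ n ∸ 1
  degree+codegree k u = trans (count-∩-∁ (neighbour? u) (λ w → col u w ≟ k)) (count-≢ u)

  heavy-if-codegreeSum-small : ∀ k → (∑[ u < n ] codegree k u) * 3 ≤ n * (n ∸ 1) * 2 → Heavy k
  heavy-if-codegreeSum-small k = third-of-split {degreeSum k} {∑[ u < n ] codegree k u} (begin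
    degreeSum k + ∑[ u < n ] codegree k u     ≡⟨ ∑-distrib-+ (degree k) (codegree k) ⟨
    ∑[ u < n ] (degree k u + codegree k u)   ≡⟨ sum-cong-≗ (degree+codegree k) ⟩
    ∑[ u < n ] (n ∸ 1)                       ≡⟨ ∑-const n (n ∸ 1) ⟩
    n * (n ∸ 1)                              ∎)
    where open ≡-Reasoning

  heavy-of-three-colours : ∀ x y z → (∀ u w → col u w ≡ x ⊎ col u w ≡ y ⊎ col u w ≡ z) → ∃ Heavy
  heavy-of-three-colours x y z within =
    [ (x ,_) , [ (y ,_) , (z ,_) ]′ ]′ (pigeonhole₃ {x = degreeSum x} {degreeSum y} {degreeSum z} (begin
      n * (n ∸ 1)                                      ≡⟨ ∑-const n (n ∸ 1) ⟨
      ∑[ u < n ] (n ∸ 1)                               ≤⟨ ∑-mono-≤ degree-bound ⟩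
      ∑[ u < n ] (degree x u + (degree y u + degree z u))
        ≡⟨ ∑-distrib-+ (degree x) (λ u → degree y u + degree z u) ⟩
      degreeSum x + ∑[ u < n ] (degree y u + degree z u)
        ≡⟨ cong (degreeSum x +_) (∑-distrib-+ (degree y) (degree z)) ⟩
      degreeSum x + (degreeSum y + degreeSum z)        ∎))
    where
    open ≤-Reasoning
    degree-bound : ∀ u → n ∸ 1 ≤ degree x u + (degree y u + degree z u)
    degree-bound u = begin
      n ∸ 1
        ≡⟨ count-≢ u ⟨
      count (neighbour? u)
        ≤⟨ count-mono (λ {w} u≢w → ⊎-map (u≢w ,_) (⊎-map (u≢w ,_) (u≢w ,_)) (within u w))
                      (neighbour? u) (via? x ∪? (via? y ∪? via? z)) ⟩
      count (via? x ∪? (via? y ∪? via? z))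
        ≤⟨ count-∪ (via? x) (via? y ∪? via? z) ⟩
      degree x u + count (via? y ∪? via? z)
        ≤⟨ +-monoʳ-≤ (degree x u) (count-∪ (via? y) (via? z)) ⟩
      degree x u + (degree y u + degree z u) ∎
      where
      via? : (k : C) → Decidable (λ w → u ≢ w × col u w ≡ k)
      via? k = neighbour-via? k u

  module Star (a : C) (z : Fin n → C) (star : ∀ u w → col u w ∈₂ (a , z u)) where

    second-colours-agree : ∀ w y → col w y ≢ a → z w ≡ z y
    second-colours-agree w y ≢a =
      trans (sym (∈₂-≢ˡ (star w y) ≢a))
            (trans (col-sym w y) (∈₂-≢ˡ (star y w) (≢a ∘ trans (col-sym w y))))

    outside? : (x : C) → Decidable (λ y → z y ≢ x)
    outside? x y = ¬? (z y ≟ x)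

    outsiders : C → ℕ
    outsiders x = count (outside? x)

    codegree-bound : ∀ x w → codegree a w ≤ degree x w + 𝟙 (outside? x w) * outsiders x
    codegree-bound x w with z w ≟ x
    ... | yes zw≡x = ≤-trans
      (count-mono (λ {y} (w≢y , ≢a) → w≢y , trans (∈₂-≢ˡ (star w y) ≢a) zw≡x)
                  (neighbour-not-via? a w) (neighbour-via? x w))
      (m≤m+n _ 0)
    ... | no zw≢x = ≤-trans
      (count-mono (λ {y} (_ , ≢a) zy≡x → zw≢x (trans (second-colours-agree w y ≢a) zy≡x))
                  (neighbour-not-via? a w) (outside? x))
      (≤-trans (m≤m+n _ 0) (m≤n+m (outsiders x + 0) (degree x w)))

    codegreeSum-bound : ∀ x → ∑[ w < n ] codegree a w ≤ degreeSum x + outsiders x * outsiders x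
    codegreeSum-bound x = begin
      ∑[ w < n ] codegree a w                    ≤⟨ ∑-mono-≤ (codegree-bound x) ⟩
      ∑[ w < n ] (degree x w + 𝟙ₒ w * outsiders x)  ≡⟨ ∑-distrib-+ (degree x) (λ w → 𝟙ₒ w * outsiders x) ⟩
      degreeSum x + ∑[ w < n ] (𝟙ₒ w * outsiders x) ≡⟨ cong (degreeSum x +_) (*-distribʳ-sum (outsiders x) 𝟙ₒ) ⟨
      degreeSum x + outsiders x * outsiders x    ∎
      where
      open ≤-Reasoning
      𝟙ₒ : Fin n → ℕ
      𝟙ₒ w = 𝟙 (outside? x w)

    outsiders+codegree : ∀ u₀ → outsiders (z u₀) + codegree a u₀ ≤ n ∸ 1
    outsiders+codegree u₀ =
      ≤-trans (+-monoˡ-≤ (codegree a u₀) outsiders-bound) (≤-reflexive (degree+codegree a u₀))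
      where
      outsiders-bound : outsiders (z u₀) ≤ degree a u₀
      outsiders-bound = count-mono
        (λ {y} zy≢zu₀ → (λ u₀≡y → zy≢zu₀ (cong z (sym u₀≡y)))
          , decidable-stable (col u₀ y ≟ a) (λ ≢a → zy≢zu₀ (sym (second-colours-agree u₀ y ≢a))))
        (outside? (z u₀)) (neighbour-via? a u₀)

    heavy : ∃ Heavy
    heavy with any? (λ u → (n ∸ 1) * 2 ≤? codegree a u * 3)
    ... | no none = a , heavy-if-codegreeSum-small a (begin
      (∑[ u < n ] codegree a u) * 3  ≡⟨ *-distribʳ-sum 3 (codegree a) ⟩
      ∑[ u < n ] (codegree a u * 3)  ≤⟨ ∑-mono-≤ (λ u → <⇒≤ (≰⇒> (none ∘ (u ,_)))) ⟩
      ∑[ u < n ] ((n ∸ 1) * 2)       ≡⟨ ∑-const n ((n ∸ 1) * 2) ⟩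
      n * ((n ∸ 1) * 2)              ≡⟨ *-assoc n (n ∸ 1) 2 ⟨
      n * (n ∸ 1) * 2                ∎)
      where open ≤-Reasoning
    ... | yes (u₀ , 2N≤3c) with n * (n ∸ 1) ≤? 3 * degreeSum (z u₀)
    ...   | yes heavy-z = z u₀ , heavy-z
    ...   | no light-z  = a , heavy-if-codegreeSum-small a
      (star-arith n {outsiders (z u₀)} {codegree a u₀} {∑[ u < n ] codegree a u} {degreeSum (z u₀)}
        2N≤3c (outsiders+codegree u₀) (codegreeSum-bound (z u₀)) (<⇒≤ (≰⇒> light-z)))

  star-of : ∀ {a} → (∀ u → a ∈₂ palette u) → ∀ u w → col u w ∈₂ (a , other _≟_ a (palette u))
  star-of a∈ u w = ∈₂-other _≟_ (palette u) (a∈ u) (col-∈ u w)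

  module ThreeColours (v u₁ u₂ : Fin n)
    (a∉u₁ : ¬ proj₁ (palette v) ∈₂ palette u₁) (b∉u₂ : ¬ proj₂ (palette v) ∈₂ palette u₂) where

    a b d : C
    a = proj₁ (palette v)
    b = proj₂ (palette v)
    d = other _≟_ b (palette u₁)

    b∈u₁ : b ∈₂ palette u₁
    b∈u₁ = col≡⇒∈ʳ v u₁ (∈₂-≢ˡ (col-∈ v u₁) (col-≢-∉ʳ v u₁ a∉u₁))

    u₁⊆bd : ∀ {y} → y ∈₂ palette u₁ → y ∈₂ (b , d)
    u₁⊆bd = ∈₂-other _≟_ (palette u₁) b∈u₁

    d∈u₂ : d ∈₂ palette u₂
    d∈u₂ = col≡⇒∈ʳ u₁ u₂ (∈₂-≢ˡ (u₁⊆bd (col-∈ u₁ u₂)) (col-≢-∉ʳ u₁ u₂ b∉u₂))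

    a∈u₂ : a ∈₂ palette u₂
    a∈u₂ = col≡⇒∈ʳ v u₂ (∈₂-≢ʳ (col-∈ v u₂) (col-≢-∉ʳ v u₂ b∉u₂))

    d≢a : d ≢ a
    d≢a = ∈₂-∉ (other-∈₂ _≟_ b (palette u₁)) a∉u₁

    u₂⊆ad : ∀ {y} → y ∈₂ palette u₂ → y ∈₂ (a , d)
    u₂⊆ad {y} y∈u₂ = subst (λ o → y ∈₂ (a , o))
      (sym (∈₂-≢ˡ (∈₂-other _≟_ (palette u₂) a∈u₂ d∈u₂) d≢a))
      (∈₂-other _≟_ (palette u₂) a∈u₂ y∈u₂)

    -- If col u w were none of a, b, d, the edges from u to v, u₁, u₂ would all have the
    -- other colour of u, which would then lie in {a, b} ∩ {b, d} ∩ {a, d} = ∅.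
    within : ∀ u w → col u w ≡ a ⊎ col u w ≡ b ⊎ col u w ≡ d
    within u w with ∈₂-other _≟_ (palette u) (col-∈ u w) (col-∈ u v)
                  | ∈₂-other _≟_ (palette u) (col-∈ u w) (col-∈ u u₁)
                  | ∈₂-other _≟_ (palette u) (col-∈ u w) (col-∈ u u₂)
    ... | inj₁ e | _ | _ = [ inj₁ , inj₂ ∘ inj₁ ]′ (col≡⇒∈ʳ u v e)
    ... | _ | inj₁ e | _ = inj₂ (u₁⊆bd (col≡⇒∈ʳ u u₁ e))
    ... | _ | _ | inj₁ e = [ inj₁ , inj₂ ∘ inj₂ ]′ (u₂⊆ad (col≡⇒∈ʳ u u₂ e))
    ... | inj₂ e₀ | inj₂ e₁ | inj₂ e₂ = ⊥-elim
      (∈₂-triangle (∈₂-∉ b∈u₁ a∉u₁) d≢a (∈₂-∉ d∈u₂ b∉u₂)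
        (col≡⇒∈ʳ u v e₀) (u₁⊆bd (col≡⇒∈ʳ u u₁ e₁)) (u₂⊆ad (col≡⇒∈ʳ u u₂ e₂)))

  _∈-palette?_ : (x : C) (u : Fin n) → Dec (x ∈₂ palette u)
  x ∈-palette? u = _∈₂?_ _≟_ x (palette u)

  heavy-colour : Fin n → ∃ Heavy
  heavy-colour v with all? (proj₁ (palette v) ∈-palette?_) | all? (proj₂ (palette v) ∈-palette?_)
  ... | yes a-everywhere | _ = Star.heavy _ _ (star-of a-everywhere)
  ... | no _ | yes b-everywhere = Star.heavy _ _ (star-of b-everywhere)
  ... | no a-missing | no b-missing with ¬∀⟶∃¬ n _ (proj₁ (palette v) ∈-palette?_) a-missing
                                       | ¬∀⟶∃¬ n _ (proj₂ (palette v) ∈-palette?_) b-missing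
  ...   | u₁ , a∉u₁ | u₂ , b∉u₂ = heavy-of-three-colours _ _ _ (ThreeColours.within v u₁ u₂ a∉u₁ b∉u₂)

module EdgeColouring {n : ℕ} {C : Set} (_≟_ : DecidableEquality C)
  (c : Edge n → C) (c-2 : IsEdge2Coloring c) where

  palette : Fin n → C × C
  palette u = proj₁ (c-2 u) , proj₁ (proj₂ (c-2 u))

  -- On the diagonal, which carries no edge, the first colour of the palette is taken,
  -- so that col u w always lies in the palette of u.
  colourBetween : (u w : Fin n) → Dec (u <ᶠ w) → Dec (w <ᶠ u) → C
  colourBetween u w (yes u<w) _         = c ((u , w) , u<w)
  colourBetween u w (no _)    (yes w<u) = c ((w , u) , w<u)
  colourBetween u w (no _)    (no _)    = proj₁ (palette u)

  col : Fin n → Fin n → C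
  col u w = colourBetween u w (u <ᶠ? w) (w <ᶠ? u)

  unordered⇒≡ : ∀ {u w : Fin n} → ¬ u <ᶠ w → ¬ w <ᶠ u → u ≡ w
  unordered⇒≡ u≮w w≮u = ≤ᶠ-antisym (≮⇒≥ w≮u) (≮⇒≥ u≮w)

  col-sym : ∀ u w → col u w ≡ col w u
  col-sym u w = by-order (u <ᶠ? w) (w <ᶠ? u)
    where
    by-order : (p : Dec (u <ᶠ w)) (q : Dec (w <ᶠ u)) → colourBetween u w p q ≡ colourBetween w u q p
    by-order (yes u<w) (yes w<u) = contradiction w<u (<ᶠ-asym u<w)
    by-order (yes _)   (no _)    = refl
    by-order (no _)    (yes _)   = refl
    by-order (no u≮w)  (no w≮u)  = cong (proj₁ ∘ palette) (unordered⇒≡ u≮w w≮u)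

  col-∈ : ∀ u w → col u w ∈₂ palette u
  col-∈ u w = by-order (u <ᶠ? w) (w <ᶠ? u)
    where
    by-order : (p : Dec (u <ᶠ w)) (q : Dec (w <ᶠ u)) → colourBetween u w p q ∈₂ palette u
    by-order (yes _) _       = proj₂ (proj₂ (c-2 u)) _ (inj₁ refl)
    by-order (no _)  (yes _) = proj₂ (proj₂ (c-2 u)) _ (inj₂ refl)
    by-order (no _)  (no _)  = inj₁ refl

  open PairColouring _≟_ col col-sym palette col-∈ public

  orientedEdge : (i j : Fin n) → Dec (i <ᶠ j) → List (Edge n)
  orientedEdge i j (yes i<j) = [ (i , j) , i<j ]
  orientedEdge i j (no _)    = []

  -- `edges n` is built from a function local to its definition; this gives it a name.
  edgeFamily : Σ (Fin n → Fin n → List (Edge n)) λ e →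
               edges n ≡ concatMap (λ i → concatMap (e i) (allFin n)) (allFin n)
  edgeFamily = _ , refl

  edgeFamily-oriented : ∀ i j → proj₁ edgeFamily i j ≡ orientedEdge i j (i <ᶠ? j)
  edgeFamily-oriented i j with i <ᶠ? j
  ... | yes _ = refl
  ... | no _  = refl

  colourCount : C → List (Edge n) → ℕ
  colourCount k es = length (filter (λ e → c e ≟ k) es)

  colorGroupSize-oriented : ∀ k →
    colorGroupSize _≟_ c k ≡ ∑[ i < n ] ∑[ j < n ] colourCount k (orientedEdge i j (i <ᶠ? j))
  colorGroupSize-oriented k = begin
    colourCount k (edges n)
      ≡⟨ cong (colourCount k) (proj₂ edgeFamily) ⟩
    colourCount k (concatMap (λ i → concatMap (family i) (allFin n)) (allFin n))
      ≡⟨ length-filter-concatMap-tabulate (λ e → c e ≟ k) id (λ i → concatMap (family i) (allFin n)) ⟩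
    ∑[ i < n ] colourCount k (concatMap (family i) (allFin n))
      ≡⟨ sum-cong-≗ (λ i → length-filter-concatMap-tabulate (λ e → c e ≟ k) id (family i)) ⟩
    ∑[ i < n ] ∑[ j < n ] colourCount k (family i j)
      ≡⟨ sum-cong-≗ (λ i → sum-cong-≗ (λ j → cong (colourCount k) (edgeFamily-oriented i j))) ⟩
    ∑[ i < n ] ∑[ j < n ] colourCount k (orientedEdge i j (i <ᶠ? j)) ∎
    where
    open ≡-Reasoning
    family : Fin n → Fin n → List (Edge n)
    family = proj₁ edgeFamily

  pair-count : ∀ k u w → 𝟙 (neighbour-via? k u w) ≡
               colourCount k (orientedEdge u w (u <ᶠ? w)) + colourCount k (orientedEdge w u (w <ᶠ? u))
  pair-count k u w = by-order (u <ᶠ? w) (w <ᶠ? u)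
    where
    by-order : (p : Dec (u <ᶠ w)) (q : Dec (w <ᶠ u)) →
      𝟙 (¬? (u ≟ᶠ w) ×-dec (colourBetween u w p q ≟ k))
        ≡ colourCount k (orientedEdge u w p) + colourCount k (orientedEdge w u q)
    by-order (yes u<w) (yes w<u) = contradiction w<u (<ᶠ-asym u<w)
    by-order (yes u<w) (no _)    = trans (𝟙-×-true (<ᶠ⇒≢ u<w) (¬? (u ≟ᶠ w)) (c uw ≟ k))
                                         (sym (trans (+-identityʳ _) (length-filter-[ (λ e → c e ≟ k) ] uw)))
      where
      uw : Edge n
      uw = (u , w) , u<w
    by-order (no _)    (yes w<u) = trans (𝟙-×-true (<ᶠ⇒≢ w<u ∘ sym) (¬? (u ≟ᶠ w)) (c wu ≟ k))
                                         (sym (length-filter-[ (λ e → c e ≟ k) ] wu))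
      where
      wu : Edge n
      wu = (w , u) , w<u
    by-order (no u≮w)  (no w≮u)  = 𝟙-no (λ (u≢w , _) → u≢w (unordered⇒≡ u≮w w≮u))
                                        (¬? (u ≟ᶠ w) ×-dec (proj₁ (palette u) ≟ k))

  handshake : ∀ k → degreeSum k ≡ 2 * colorGroupSize _≟_ c k
  handshake k = begin
    degreeSum k
      ≡⟨ sum-cong-≗ (λ u → sum-cong-≗ (pair-count k u)) ⟩
    ∑[ u < n ] ∑[ w < n ] (oriented u w + oriented w u)
      ≡⟨ sum-cong-≗ (λ u → ∑-distrib-+ (oriented u) (λ w → oriented w u)) ⟩
    ∑[ u < n ] (∑[ w < n ] oriented u w + ∑[ w < n ] oriented w u)
      ≡⟨ ∑-distrib-+ (λ u → ∑[ w < n ] oriented u w) (λ u → ∑[ w < n ] oriented w u) ⟩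
    E + ∑[ u < n ] ∑[ w < n ] oriented w u
      ≡⟨ cong (E +_) (∑-comm (λ u w → oriented w u)) ⟩
    E + E
      ≡⟨ cong (E +_) (+-identityʳ E) ⟨
    2 * E
      ≡⟨ cong (2 *_) (colorGroupSize-oriented k) ⟨
    2 * colorGroupSize _≟_ c k ∎
    where
    open ≡-Reasoning
    oriented : Fin n → Fin n → ℕ
    oriented i j = colourCount k (orientedEdge i j (i <ᶠ? j))
    E : ℕ
    E = ∑[ i < n ] ∑[ j < n ] oriented i j

theorem4 : (n : ℕ) → 1 ≤ n → {C : Set} → (_≟_ : DecidableEquality C) →
    (c : Edge n → C) → IsEdge2Coloring c →
    Σ C λ k → ceilDiv6 (n * (n ∸ 1)) ≤ colorGroupSize _≟_ c k
theorem4 n 1≤n _≟_ c c-2 =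
  let k , heavy = heavy-colour (fromℕ< 1≤n)
  in  k , ceilDiv6-≤ (≤-trans heavy (≤-reflexive (cong (3 *_) (handshake k))))
  where open EdgeColouring _≟_ c c-2
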